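{- For every prime $m>3$, the Cartesian product graph $\Gamma(\mathbb{Z}_9)\times\Gamma(\mathbb{Z}_{m^2})$ admits a distance antimagic labeling.
   Context: For an integer $n \geq 2$, the zero-divisor graph $\Gamma(\mathbb{Z}_n)$ is the simple graph whose vertex set is the set of nonzero zero-divisors of the ring $\mathbb{Z}_n$, two distinct vertices $u,v$ being adjacent iff $uv \equiv 0 \pmod n$. The Cartesian product $G\times H$ has vertex set $V(G)\times V(H)$, with $(u,v)$ adjacent to $(u',v')$ iff either $u=u'$ and $vv'\in E(H)$, or $v=v'$ and $uu'\in E(G)$. A distance antimagic labeling (DAML) of a graph $G$ with $N$ vertices is a bijection $f:V(G)\to\{1,\dots,N\}$ such that the weights $w(v)=\sum_{u\in N(v)} f(u)$, where $N(v)$ is the open neighbourhood of $v$, are pairwise distinct over all vertices $v$. A graph admits DAML if such a labeling exists. -}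

module Defs where

open import Data.Nat using (ℕ; zero; suc; _+_; _*_; _≤_; _%_)
open import Data.Nat.Properties using (_≟_)
open import Data.Bool using (Bool; true; false; _∧_; _∨_; not)
open import Data.List using (List; []; _∷_; filter; map; length; cartesianProduct; upTo)
open import Data.Nat.ListAction using (sum)
open import Data.Bool.ListAction using (any)
open import Data.List.Membership.Propositional using (_∈_)
open import Data.Product using (Σ; _×_; _,_; proj₁; proj₂)
open import Relation.Nullary using (does)
open import Relation.Nullary.Decidable using (⌊_⌋)
open import Relation.Binary.PropositionalEquality using (_≡_)
open import Relation.Binary using (DecidableEquality)
open import Data.Product.Properties using (≡-dec)

-- A finite simple graph: a vertex type with decidable equality, the list of
-- its vertices (without repetitions), and a Boolean adjacency relation.
record Graph : Set₁ where
  field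
    V     : Set
    _≟V_  : DecidableEquality V
    verts : List V
    adj   : V → V → Bool

open Graph public

-- Zero-divisor graph Γ(ℤ_n): vertices are the a ∈ {1,…,n-1} such that
-- a*b ≡ 0 (mod n) for some b ∈ {1,…,n-1}; distinct u,v adjacent iff uv ≡ 0 (mod n).
isZeroMod : ℕ → ℕ → Bool
isZeroMod zero    x = ⌊ x ≟ 0 ⌋
isZeroMod (suc k) x = ⌊ x % suc k ≟ 0 ⌋

nonzeroResidues : ℕ → List ℕ
nonzeroResidues n = filter (λ a → Relation.Nullary.¬? (a ≟ 0)) (upTo n)

isZeroDivisor : ℕ → ℕ → Bool
isZeroDivisor n a = any (λ b → isZeroMod n (a * b)) (nonzeroResidues n)

ZDGraph : ℕ → Graph
ZDGraph n = record
  { V     = ℕ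
  ; _≟V_  = _≟_
  ; verts = filter (λ a → isZeroDivisor n a Data.Bool.≟ true) (nonzeroResidues n)
  ; adj   = λ u v → not ⌊ u ≟ v ⌋ ∧ isZeroMod n (u * v)
  }

_□_ : Graph → Graph → Graph
G □ H = record
  { V     = V G × V H
  ; _≟V_  = ≡-dec (_≟V_ G) (_≟V_ H)
  ; verts = cartesianProduct (verts G) (verts H)
  ; adj   = λ { (u , v) (u' , v') →
              (⌊ (_≟V_ G) u u' ⌋ ∧ adj H v v') ∨ (⌊ (_≟V_ H) v v' ⌋ ∧ adj G u u') }
  }

weight : (G : Graph) → (V G → ℕ) → V G → ℕ
weight G f v = sum (map f (filter (λ u → adj G v u Data.Bool.≟ true) (verts G)))

IsDAML : (G : Graph) → (V G → ℕ) → Set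
IsDAML G f =
    (∀ {u} → u ∈ verts G → 1 ≤ f u × f u ≤ length (verts G))
  × (∀ {u v} → u ∈ verts G → v ∈ verts G → f u ≡ f v → u ≡ v)
  × (∀ {u v} → u ∈ verts G → v ∈ verts G → weight G f u ≡ weight G f v → u ≡ v)

AdmitsDAML : Graph → Set
AdmitsDAML G = Σ (V G → ℕ) (IsDAML G)

-- Γ(ℤ₉) is K₂ on {3, 6}, and for a prime p every zero-divisor mod p² is a multiple of p, so
-- Γ(ℤ_{p²}) is the complete graph K_k, k = p − 1 ≥ 4.  In K₂ □ K_k give the vertex of index i
-- label i + 1 in row 3 and 2k − i in row 6.  With S₃, S₆ the row sums, the weights are
-- S₃ + 2k − (2i + 1) in row 3 and S₆ − 2k + (2i + 1) in row 6, injective within each row;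
-- and as S₆ = S₃ + k², row 3 stays below S₃ + 2k ≤ S₆ − 2k, below row 6, as soon as 4k ≤ k².
module Submission where

open import Defs
open import Data.Bool using (Bool; true; false; _∧_; _∨_; not; if_then_else_)
import Data.Bool as Bool
open import Data.Bool.Properties using (∧-identityʳ; ∧-zeroʳ; ∨-identityʳ; T-≡)
open import Data.Empty using (⊥-elim)
open import Data.List using (List; []; _∷_; map; filter; length; _++_; upTo; applyUpTo)
open import Data.List.Properties
  using ( map-++; ++-identityʳ; map-∘; map-cong-local; map-upTo; upTo-∷ʳ; length-map; length-upTo; length-++
        ; filter-++; filter-all; filter-none)
open import Data.List.Membership.Propositional using (_∈_; find; lose)
open import Data.List.Membership.Propositional.Properties
  using (∈-upTo⁻; ∈-upTo⁺; ∈-map⁻; ∈-filter⁺; ∈-filter⁻; ∈-cartesianProduct⁻)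
open import Data.List.Relation.Binary.Subset.Propositional using (_⊆_)
open import Data.List.Relation.Unary.All as All using (All; _∷_)
open import Data.List.Relation.Unary.AllPairs using (_∷_)
open import Data.List.Relation.Unary.Any using (here; there)
open import Data.List.Relation.Unary.Any.Properties using (any⁺; any⁻)
open import Data.List.Relation.Unary.Unique.Propositional using (Unique)
import Data.List.Relation.Unary.Unique.Propositional.Properties as Unique
open import Data.Nat
open import Data.Nat.Properties
open import Data.Nat.Divisibility
  using (_∣_; divides; m%n≡0⇒n∣m; n∣m⇒m%n≡0; ∣-trans; m∣m*n; *-cancelʳ-∣; *-monoˡ-∣; *-pres-∣; ∣⇒≤)
open import Data.Nat.ListAction using (sum)
open import Data.Nat.ListAction.Properties using (sum-++)
open import Data.Nat.Primality
  using (Prime; euclidsLemma; prime⇒nonZero; prime⇒nonTrivial; composite[4]; composite⇒¬prime)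
open import Data.Nat.Tactic.RingSolver using (solve-∀)
open import Data.Product using (∃-syntax; _×_; _,_)
open import Data.Sum using (_⊎_; inj₁; inj₂)
open import Function using (_∘_; Equivalence)
open import Relation.Binary using (DecidableEquality)
open import Relation.Binary.PropositionalEquality
open import Relation.Nullary using (Dec; yes; no; ¬_; ¬?)
open import Relation.Nullary.Decidable using (⌊_⌋; isYes≗does; dec-false)

filterᵇ : {A : Set} → (A → Bool) → List A → List A
filterᵇ p = filter (λ a → p a Bool.≟ true)

module _ {A B : Set} where

  filterᵇ-map : (p : B → Bool) (h : A → B) (xs : List A) →
                filterᵇ p (map h xs) ≡ map h (filterᵇ (p ∘ h) xs)
  filterᵇ-map p h []       = refl
  filterᵇ-map p h (x ∷ xs) with p (h x)
  ... | true  = cong (h x ∷_) (filterᵇ-map p h xs)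
  ... | false = filterᵇ-map p h xs

  sum-map-filterᵇ-map : (f : B → ℕ) (p : B → Bool) (h : A → B) (xs : List A) →
                        sum (map f (filterᵇ p (map h xs))) ≡ sum (map (f ∘ h) (filterᵇ (p ∘ h) xs))
  sum-map-filterᵇ-map f p h xs = begin
    sum (map f (filterᵇ p (map h xs)))       ≡⟨ cong (sum ∘ map f) (filterᵇ-map p h xs) ⟩
    sum (map f (map h (filterᵇ (p ∘ h) xs))) ≡⟨ cong sum (map-∘ (filterᵇ (p ∘ h) xs)) ⟨
    sum (map (f ∘ h) (filterᵇ (p ∘ h) xs))   ∎
    where open ≡-Reasoning

module _ {A : Set} where

  filterᵇ-cong-∈ : (p q : A → Bool) (xs : List A) → (∀ {x} → x ∈ xs → p x ≡ q x) →
                   filterᵇ p xs ≡ filterᵇ q xs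
  filterᵇ-cong-∈ p q []       p≗q = refl
  filterᵇ-cong-∈ p q (x ∷ xs) p≗q with p x | q x | p≗q (here refl)
  ... | true  | true  | refl = cong (x ∷_) (filterᵇ-cong-∈ p q xs (p≗q ∘ there))
  ... | false | false | refl = filterᵇ-cong-∈ p q xs (p≗q ∘ there)

  sum-map-++ : (f : A → ℕ) (xs ys : List A) → sum (map f (xs ++ ys)) ≡ sum (map f xs) + sum (map f ys)
  sum-map-++ f xs ys = trans (cong sum (map-++ f xs ys)) (sum-++ (map f xs) (map f ys))

  remove-∈ : ∀ {x : A} ys → x ∈ ys →
             ∃[ zs ] length ys ≡ suc (length zs) × (∀ {y} → y ∈ ys → y ≢ x → y ∈ zs)
  remove-∈ (y ∷ ys) (here refl) = ys , refl , λ { (here y≡x) y≢x → ⊥-elim (y≢x y≡x) ; (there y∈) _ → y∈ }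
  remove-∈ (y ∷ ys) (there x∈)  with zs , len , keep ← remove-∈ ys x∈ =
    y ∷ zs , cong suc len , λ { (here y≡) _ → here y≡ ; (there z∈) z≢x → there (keep z∈ z≢x) }

  unique-⊆⇒length-≤ : ∀ {xs ys : List A} → Unique xs → xs ⊆ ys → length xs ≤ length ys
  unique-⊆⇒length-≤ {[]}     _            _  = z≤n
  unique-⊆⇒length-≤ {x ∷ xs} {ys} (x∉xs ∷ u) xs⊆ys with zs , len , keep ← remove-∈ ys (xs⊆ys (here refl)) =
    subst (suc (length xs) ≤_) (sym len)
      (s≤s (unique-⊆⇒length-≤ u (λ y∈ → keep (xs⊆ys (there y∈)) (≢-sym (All.lookup x∉xs y∈)))))

⌊⌋≡false : ∀ {P : Set} (P? : Dec P) → ¬ P → ⌊ P? ⌋ ≡ false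
⌊⌋≡false P? ¬p = trans (isYes≗does P?) (dec-false P? ¬p)

module _ {A : Set} (_≟_ : DecidableEquality A) where

  filterᵇ-≢-all : ∀ {x ys} → All (x ≢_) ys → filterᵇ (λ y → not ⌊ x ≟ y ⌋) ys ≡ ys
  filterᵇ-≢-all {x} = filter-all _ ∘ All.map (λ x≢y → cong not (⌊⌋≡false (x ≟ _) x≢y))

  filterᵇ-≡-none : ∀ {x ys} → All (x ≢_) ys → filterᵇ (λ y → ⌊ x ≟ y ⌋) ys ≡ []
  filterᵇ-≡-none {x} = filter-none _ ∘ All.map (λ x≢y → subst (_≢ true) (sym (⌊⌋≡false (x ≟ _) x≢y)) λ ())

  sum-filter-≢ : (g : A → ℕ) {x : A} (xs : List A) → Unique xs → x ∈ xs →
                 sum (map g (filterᵇ (λ y → not ⌊ x ≟ y ⌋) xs)) + g x ≡ sum (map g xs)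
  sum-filter-≢ g {x} (y ∷ ys) (y∉ys ∷ u) x∈ with x ≟ y
  sum-filter-≢ g (y ∷ ys) (y∉ys ∷ u) x∈ | yes refl
    rewrite filterᵇ-≢-all y∉ys = +-comm (sum (map g ys)) (g y)
  sum-filter-≢ g (y ∷ ys) (y∉ys ∷ u) (here x≡y) | no x≢y = ⊥-elim (x≢y x≡y)
  sum-filter-≢ g {x} (y ∷ ys) (y∉ys ∷ u) (there x∈) | no x≢y =
    trans (+-assoc (g y) _ (g x)) (cong (g y +_) (sum-filter-≢ g ys u x∈))

  sum-filter-≡ : (g : A → ℕ) {x : A} (xs : List A) → Unique xs → x ∈ xs →
                 sum (map g (filterᵇ (λ y → ⌊ x ≟ y ⌋) xs)) ≡ g x
  sum-filter-≡ g {x} (y ∷ ys) (y∉ys ∷ u) x∈ with x ≟ y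
  sum-filter-≡ g (y ∷ ys) (y∉ys ∷ u) x∈ | yes refl
    rewrite filterᵇ-≡-none y∉ys = +-identityʳ (g y)
  sum-filter-≡ g (y ∷ ys) (y∉ys ∷ u) (here x≡y) | no x≢y = ⊥-elim (x≢y x≡y)
  sum-filter-≡ g (y ∷ ys) (y∉ys ∷ u) (there x∈) | no x≢y = sum-filter-≡ g ys u x∈

  indexOf : List A → A → ℕ
  indexOf []       x = 0
  indexOf (y ∷ ys) x = if ⌊ x ≟ y ⌋ then 0 else suc (indexOf ys x)

  indexOf-< : ∀ {x} xs → x ∈ xs → indexOf xs x < length xs
  indexOf-< {x} (y ∷ ys) x∈ with x ≟ y
  ... | yes _ = s≤s z≤n
  indexOf-< (y ∷ ys) (here x≡y)  | no x≢y = ⊥-elim (x≢y x≡y)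
  indexOf-< (y ∷ ys) (there x∈)  | no _   = s≤s (indexOf-< ys x∈)

  indexOf-injective : ∀ {x z} xs → x ∈ xs → z ∈ xs → indexOf xs x ≡ indexOf xs z → x ≡ z
  indexOf-injective {x} {z} (y ∷ ys) x∈ z∈ eq with x ≟ y | z ≟ y
  ... | yes x≡y | yes z≡y = trans x≡y (sym z≡y)
  ... | yes _   | no _    = ⊥-elim (0≢1+n eq)
  ... | no _    | yes _   = ⊥-elim (0≢1+n (sym eq))
  indexOf-injective (y ∷ ys) (here x≡y) _          _  | no x≢y | no _    = ⊥-elim (x≢y x≡y)
  indexOf-injective (y ∷ ys) (there _)  (here z≡y) _  | no _   | no z≢y  = ⊥-elim (z≢y z≡y)
  indexOf-injective (y ∷ ys) (there x∈) (there z∈) eq | no _   | no _    =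
    indexOf-injective ys x∈ z∈ (suc-injective eq)

  map-indexOf : ∀ xs → Unique xs → map (indexOf xs) xs ≡ upTo (length xs)
  map-indexOf []       _            = refl
  map-indexOf (y ∷ ys) (y∉ys ∷ u) with y ≟ y
  ... | no y≢y = ⊥-elim (y≢y refl)
  ... | yes _  = cong (0 ∷_) (begin
    map (indexOf (y ∷ ys)) ys     ≡⟨ map-cong-local (All.map skip y∉ys) ⟩
    map (suc ∘ indexOf ys) ys     ≡⟨ map-∘ ys ⟩
    map suc (map (indexOf ys) ys) ≡⟨ cong (map suc) (map-indexOf ys u) ⟩
    map suc (upTo (length ys))    ≡⟨ map-upTo suc (length ys) ⟩
    applyUpTo suc (length ys)     ∎)
    where
    open ≡-Reasoning
    skip : ∀ {z} → y ≢ z → indexOf (y ∷ ys) z ≡ suc (indexOf ys z)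
    skip {z} y≢z with z ≟ y
    ... | yes z≡y = ⊥-elim (y≢z (sym z≡y))
    ... | no _    = refl

sum-map-suc : ∀ xs → sum (map suc xs) ≡ sum xs + length xs
sum-map-suc []       = refl
sum-map-suc (x ∷ xs) = trans (cong (suc x +_) (sum-map-suc xs)) (shuffle x (sum xs) (length xs))
  where
  shuffle : ∀ a b c → suc a + (b + c) ≡ a + b + suc c
  shuffle = solve-∀

sum-map-∸ : ∀ c xs → All (_≤ c) xs → sum (map (c ∸_) xs) + sum xs ≡ length xs * c
sum-map-∸ c []       _          = refl
sum-map-∸ c (x ∷ xs) (x≤c ∷ xs≤c) = begin
  (c ∸ x) + sum (map (c ∸_) xs) + (x + sum xs)   ≡⟨ shuffle (c ∸ x) (sum (map (c ∸_) xs)) x (sum xs) ⟩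
  ((c ∸ x) + x) + (sum (map (c ∸_) xs) + sum xs) ≡⟨ cong₂ _+_ (m∸n+n≡m x≤c) (sum-map-∸ c xs xs≤c) ⟩
  c + length xs * c                              ∎
  where
  open ≡-Reasoning
  shuffle : ∀ a b d e → a + b + (d + e) ≡ (a + d) + (b + e)
  shuffle = solve-∀

sum-upTo-twice : ∀ k → sum (upTo k) + sum (upTo k) + k ≡ k * k
sum-upTo-twice zero    = refl
sum-upTo-twice (suc k) = begin
  T′ + T′ + suc k           ≡⟨ cong (λ t → t + t + suc k) sum-upTo-suc ⟩
  (T + k) + (T + k) + suc k ≡⟨ shuffle T k ⟩
  suc (T + T + k + (k + k)) ≡⟨ cong (λ t → suc (t + (k + k))) (sum-upTo-twice k) ⟩
  suc (k * k + (k + k))     ≡⟨ cong suc (square k) ⟩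
  suc k * suc k             ∎
  where
  open ≡-Reasoning
  T T′ : ℕ
  T = sum (upTo k)
  T′ = sum (upTo (suc k))
  sum-upTo-suc : T′ ≡ T + k
  sum-upTo-suc = begin
    T′                       ≡⟨ cong sum (upTo-∷ʳ k) ⟨
    sum (upTo k ++ (k ∷ [])) ≡⟨ sum-++ (upTo k) (k ∷ []) ⟩
    T + (k + 0)              ≡⟨ cong (T +_) (+-identityʳ k) ⟩
    T + k                    ∎
  shuffle : ∀ t k → (t + k) + (t + k) + suc k ≡ suc (t + t + k + (k + k))
  shuffle = solve-∀
  square : ∀ k → k * k + (k + k) ≡ k + k * suc k
  square = solve-∀

row-sums : ∀ k → sum (map suc (upTo k)) + k * k ≡ sum (map ((k + k) ∸_) (upTo k))
row-sums k = +-cancelʳ-≡ T _ _ (begin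
  sum (map suc (upTo k)) + k * k + T  ≡⟨ cong (λ s → s + k * k + T) (sum-map-suc (upTo k)) ⟩
  T + length (upTo k) + k * k + T     ≡⟨ cong (λ l → T + l + k * k + T) (length-upTo k) ⟩
  T + k + k * k + T                   ≡⟨ shuffle T k (k * k) ⟩
  k * k + (T + T + k)                 ≡⟨ cong (k * k +_) (sum-upTo-twice k) ⟩
  k * k + k * k                       ≡⟨ *-distribˡ-+ k k k ⟨
  k * (k + k)                         ≡⟨ cong (_* (k + k)) (length-upTo k) ⟨
  length (upTo k) * (k + k)           ≡⟨ sum-map-∸ (k + k) (upTo k) (All.tabulate below) ⟨
  sum (map ((k + k) ∸_) (upTo k)) + T ∎)
  where
  open ≡-Reasoning
  T : ℕ
  T = sum (upTo k)
  shuffle : ∀ t k s → t + k + s + t ≡ s + (t + t + k)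
  shuffle = solve-∀
  below : ∀ {i} → i ∈ upTo k → i ≤ k + k
  below i∈ = ≤-trans (<⇒≤ (∈-upTo⁻ i∈)) (m≤m+n k k)

odd-injective : ∀ i j → suc i + i ≡ suc j + j → i ≡ j
odd-injective zero    zero    _  = refl
odd-injective (suc i) (suc j) eq rewrite +-suc i i | +-suc j j =
  cong suc (odd-injective i j (suc-injective (suc-injective eq)))

IsComplete : Graph → Set
IsComplete H = ∀ {x y} → x ∈ verts H → y ∈ verts H → adj H x y ≡ not ⌊ _≟V_ H x y ⌋

module K₂□Complete (H : Graph) (unique : Unique (verts H)) (complete : IsComplete H)
                   (4≤k : 4 ≤ length (verts H)) where

  private
    _≟H_ : DecidableEquality (V H)
    _≟H_ = _≟V_ H
    L : List (V H)
    L = verts H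
    k c : ℕ
    k = length L
    c = k + k
    G : Graph
    G = ZDGraph 9 □ H

  ι : V H → ℕ
  ι = indexOf _≟H_ L

  lo hi : V H → ℕ
  lo x = suc (ι x)
  hi x = c ∸ ι x

  row : ℕ → List (V G)
  row a = map (a ,_) L

  label : V G → ℕ
  label (a , x) = if a ≡ᵇ 3 then lo x else hi x

  -- For a, b ∈ {3, 6}, adj G (a , x) (b , y) reduces to adjSameRow x y if a ≡ b, else to adjOtherRow x y.
  adjSameRow adjOtherRow : V H → V H → Bool
  adjSameRow x y  = adj H x y ∨ (⌊ x ≟H y ⌋ ∧ false)
  adjOtherRow x y = ⌊ x ≟H y ⌋ ∧ true

  weight-split : ∀ v → weight G label v ≡
    sum (map lo (filterᵇ (λ y → adj G v (3 , y)) L)) + sum (map hi (filterᵇ (λ y → adj G v (6 , y)) L))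
  weight-split v = begin
    sum (map label (filterᵇ p (row 3 ++ row 6 ++ [])))
      ≡⟨ cong (λ r → sum (map label (filterᵇ p (row 3 ++ r)))) (++-identityʳ (row 6)) ⟩
    sum (map label (filterᵇ p (row 3 ++ row 6)))
      ≡⟨ cong (sum ∘ map label) (filter-++ _ (row 3) (row 6)) ⟩
    sum (map label (filterᵇ p (row 3) ++ filterᵇ p (row 6)))
      ≡⟨ sum-map-++ label (filterᵇ p (row 3)) (filterᵇ p (row 6)) ⟩
    sum (map label (filterᵇ p (row 3))) + sum (map label (filterᵇ p (row 6)))
      ≡⟨ cong₂ _+_ (sum-map-filterᵇ-map label p (3 ,_) L) (sum-map-filterᵇ-map label p (6 ,_) L) ⟩
    sum (map lo (filterᵇ (λ y → adj G v (3 , y)) L)) + sum (map hi (filterᵇ (λ y → adj G v (6 , y)) L)) ∎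
    where
    open ≡-Reasoning
    p : V G → Bool
    p = adj G v

  sum-adjSameRow : ∀ {x} → x ∈ L → (g : V H → ℕ) →
                   sum (map g (filterᵇ (adjSameRow x) L)) + g x ≡ sum (map g L)
  sum-adjSameRow {x} x∈ g = begin
    sum (map g (filterᵇ (adjSameRow x) L)) + g x
      ≡⟨ cong (λ ys → sum (map g ys) + g x) (filterᵇ-cong-∈ _ _ L same) ⟩
    sum (map g (filterᵇ (λ y → not ⌊ x ≟H y ⌋) L)) + g x
      ≡⟨ sum-filter-≢ _≟H_ g L unique x∈ ⟩
    sum (map g L) ∎
    where
    open ≡-Reasoning
    same : ∀ {y} → y ∈ L → adjSameRow x y ≡ not ⌊ x ≟H y ⌋
    same y∈ = trans (cong₂ _∨_ (complete x∈ y∈) (∧-zeroʳ _)) (∨-identityʳ _)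

  sum-adjOtherRow : ∀ {x} → x ∈ L → (g : V H → ℕ) → sum (map g (filterᵇ (adjOtherRow x) L)) ≡ g x
  sum-adjOtherRow {x} x∈ g =
    trans (cong (sum ∘ map g) (filterᵇ-cong-∈ _ _ L (λ _ → ∧-identityʳ _))) (sum-filter-≡ _≟H_ g L unique x∈)

  S₃ S₆ : ℕ
  S₃ = sum (map lo L)
  S₆ = sum (map hi L)

  weight-row3 : ∀ {x} → x ∈ L → weight G label (3 , x) + lo x ≡ S₃ + hi x
  weight-row3 {x} x∈ = begin
    weight G label (3 , x) + lo x ≡⟨ cong (_+ lo x) (weight-split (3 , x)) ⟩
    same + other + lo x           ≡⟨ +-assoc same other (lo x) ⟩
    same + (other + lo x)         ≡⟨ cong (same +_) (+-comm other (lo x)) ⟩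
    same + (lo x + other)         ≡⟨ +-assoc same (lo x) other ⟨
    same + lo x + other           ≡⟨ cong₂ _+_ (sum-adjSameRow x∈ lo) (sum-adjOtherRow x∈ hi) ⟩
    S₃ + hi x                     ∎
    where
    open ≡-Reasoning
    same other : ℕ
    same = sum (map lo (filterᵇ (adjSameRow x) L))
    other = sum (map hi (filterᵇ (adjOtherRow x) L))

  weight-row6 : ∀ {x} → x ∈ L → weight G label (6 , x) + hi x ≡ lo x + S₆
  weight-row6 {x} x∈ = begin
    weight G label (6 , x) + hi x ≡⟨ cong (_+ hi x) (weight-split (6 , x)) ⟩
    other + same + hi x           ≡⟨ +-assoc other same (hi x) ⟩
    other + (same + hi x)         ≡⟨ cong₂ _+_ (sum-adjOtherRow x∈ lo) (sum-adjSameRow x∈ hi) ⟩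
    lo x + S₆                     ∎
    where
    open ≡-Reasoning
    same other : ℕ
    same = sum (map hi (filterᵇ (adjSameRow x) L))
    other = sum (map lo (filterᵇ (adjOtherRow x) L))

  ι<k : ∀ {x} → x ∈ L → ι x < k
  ι<k = indexOf-< _≟H_ L

  ι≤c : ∀ {x} → x ∈ L → ι x ≤ c
  ι≤c x∈ = ≤-trans (<⇒≤ (ι<k x∈)) (m≤m+n k k)

  hi+ι≡c : ∀ {x} → x ∈ L → hi x + ι x ≡ c
  hi+ι≡c x∈ = m∸n+n≡m (ι≤c x∈)

  lo<hi : ∀ {x y} → x ∈ L → y ∈ L → lo x < hi y
  lo<hi x∈ y∈ = ≤-<-trans (ι<k x∈) (subst (_< hi _) (m+n∸n≡m k k) (∸-monoʳ-< (ι<k y∈) (m≤m+n k k)))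

  weight-row3-odd : ∀ {x} → x ∈ L → weight G label (3 , x) + (suc (ι x) + ι x) ≡ S₃ + c
  weight-row3-odd {x} x∈ = begin
    w + (lo x + ι x)  ≡⟨ +-assoc w (lo x) (ι x) ⟨
    w + lo x + ι x    ≡⟨ cong (_+ ι x) (weight-row3 x∈) ⟩
    S₃ + hi x + ι x   ≡⟨ +-assoc S₃ (hi x) (ι x) ⟩
    S₃ + (hi x + ι x) ≡⟨ cong (S₃ +_) (hi+ι≡c x∈) ⟩
    S₃ + c            ∎
    where
    open ≡-Reasoning
    w : ℕ
    w = weight G label (3 , x)

  weight-row6-odd : ∀ {x} → x ∈ L → weight G label (6 , x) + c ≡ S₆ + (suc (ι x) + ι x)
  weight-row6-odd {x} x∈ = begin
    w + c             ≡⟨ cong (w +_) (hi+ι≡c x∈) ⟨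
    w + (hi x + ι x)  ≡⟨ +-assoc w (hi x) (ι x) ⟨
    w + hi x + ι x    ≡⟨ cong (_+ ι x) (weight-row6 x∈) ⟩
    lo x + S₆ + ι x   ≡⟨ cong (_+ ι x) (+-comm (lo x) S₆) ⟩
    S₆ + lo x + ι x   ≡⟨ +-assoc S₆ (lo x) (ι x) ⟩
    S₆ + (lo x + ι x) ∎
    where
    open ≡-Reasoning
    w : ℕ
    w = weight G label (6 , x)

  S₃+k*k≡S₆ : S₃ + k * k ≡ S₆
  S₃+k*k≡S₆ = begin
    sum (map lo L) + k * k          ≡⟨ cong (λ ls → sum ls + k * k) (map-∘ L) ⟩
    sum (map suc (map ι L)) + k * k ≡⟨ cong (λ is → sum (map suc is) + k * k) indices ⟩
    sum (map suc (upTo k)) + k * k  ≡⟨ row-sums k ⟩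
    sum (map (c ∸_) (upTo k))       ≡⟨ cong (sum ∘ map (c ∸_)) indices ⟨
    sum (map (c ∸_) (map ι L))      ≡⟨ cong sum (map-∘ L) ⟨
    sum (map hi L)                  ∎
    where
    open ≡-Reasoning
    indices : map ι L ≡ upTo k
    indices = map-indexOf _≟H_ L unique

  c+c≤k*k : c + c ≤ k * k
  c+c≤k*k = subst (_≤ k * k) (four-k k) (*-monoˡ-≤ k 4≤k)
    where
    four-k : ∀ k → 4 * k ≡ (k + k) + (k + k)
    four-k = solve-∀

  rows-separated : ∀ {x y} → x ∈ L → y ∈ L → weight G label (3 , x) ≢ weight G label (6 , y)
  rows-separated {x} {y} x∈ y∈ w₃≡w₆ = <-irrefl refl (begin-strict
    S₆                         <⟨ m<m+n S₆ z<s ⟩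
    S₆ + (suc (ι y) + ι y)     ≡⟨ weight-row6-odd y∈ ⟨
    w₆ + c                     ≡⟨ cong (_+ c) w₃≡w₆ ⟨
    w₃ + c                     <⟨ +-monoˡ-< c (m<m+n w₃ z<s) ⟩
    w₃ + (suc (ι x) + ι x) + c ≡⟨ cong (_+ c) (weight-row3-odd x∈) ⟩
    S₃ + c + c                 ≡⟨ +-assoc S₃ c c ⟩
    S₃ + (c + c)               ≤⟨ +-monoʳ-≤ S₃ c+c≤k*k ⟩
    S₃ + k * k                 ≡⟨ S₃+k*k≡S₆ ⟩
    S₆                         ∎)
    where
    open ≤-Reasoning
    w₃ w₆ : ℕ
    w₃ = weight G label (3 , x)
    w₆ = weight G label (6 , y)

  length-verts : length (verts G) ≡ c
  length-verts = begin
    length (row 3 ++ row 6 ++ [])         ≡⟨ length-++ (row 3) ⟩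
    length (row 3) + length (row 6 ++ []) ≡⟨ cong (λ r → length (row 3) + length r) (++-identityʳ (row 6)) ⟩
    length (row 3) + length (row 6)       ≡⟨ cong₂ _+_ (length-row 3) (length-row 6) ⟩
    c                                     ∎
    where
    open ≡-Reasoning
    length-row : ∀ a → length (row a) ≡ k
    length-row a = length-map (a ,_) L

  label-bounds : ∀ {v} → v ∈ verts G → 1 ≤ label v × label v ≤ length (verts G)
  label-bounds {a , x} v∈ rewrite length-verts with ∈-cartesianProduct⁻ (verts (ZDGraph 9)) L v∈
  ... | here refl         , x∈ = s≤s z≤n , ≤-trans (ι<k x∈) (m≤m+n k k)
  ... | there (here refl) , x∈ = ≤-<-trans z≤n (lo<hi x∈ x∈) , m∸n≤m c (ι x)

  label-injective : ∀ {u v} → u ∈ verts G → v ∈ verts G → label u ≡ label v → u ≡ v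
  label-injective {_ , x} {_ , y} u∈ v∈ eq
    with ∈-cartesianProduct⁻ (verts (ZDGraph 9)) L u∈ | ∈-cartesianProduct⁻ (verts (ZDGraph 9)) L v∈
  ... | here refl         , x∈ | here refl         , y∈ =
    cong (3 ,_) (indexOf-injective _≟H_ L x∈ y∈ (suc-injective eq))
  ... | here refl         , x∈ | there (here refl) , y∈ = ⊥-elim (<⇒≢ (lo<hi x∈ y∈) eq)
  ... | there (here refl) , x∈ | here refl         , y∈ = ⊥-elim (<⇒≢ (lo<hi y∈ x∈) (sym eq))
  ... | there (here refl) , x∈ | there (here refl) , y∈ =
    cong (6 ,_) (indexOf-injective _≟H_ L x∈ y∈ (∸-cancelˡ-≡ (ι≤c x∈) (ι≤c y∈) eq))

  weight-injective : ∀ {u v} → u ∈ verts G → v ∈ verts G → weight G label u ≡ weight G label v → u ≡ v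
  weight-injective {_ , x} {_ , y} u∈ v∈ eq
    with ∈-cartesianProduct⁻ (verts (ZDGraph 9)) L u∈ | ∈-cartesianProduct⁻ (verts (ZDGraph 9)) L v∈
  ... | here refl         , x∈ | here refl         , y∈ =
    cong (3 ,_) (indexOf-injective _≟H_ L x∈ y∈ (odd-injective _ _ (+-cancelˡ-≡ _ _ _
      (trans (weight-row3-odd x∈) (trans (sym (weight-row3-odd y∈)) (cong (_+ _) (sym eq)))))))
  ... | here refl         , x∈ | there (here refl) , y∈ = ⊥-elim (rows-separated x∈ y∈ eq)
  ... | there (here refl) , x∈ | here refl         , y∈ = ⊥-elim (rows-separated y∈ x∈ (sym eq))
  ... | there (here refl) , x∈ | there (here refl) , y∈ =
    cong (6 ,_) (indexOf-injective _≟H_ L x∈ y∈ (odd-injective _ _ (+-cancelˡ-≡ S₆ _ _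
      (trans (sym (weight-row6-odd x∈)) (trans (cong (_+ c) eq) (weight-row6-odd y∈))))))

  admitsDAML : AdmitsDAML G
  admitsDAML = label , label-bounds , label-injective , weight-injective

isZeroMod⇒∣ : ∀ {n z} .{{_ : NonZero n}} → isZeroMod n z ≡ true → n ∣ z
isZeroMod⇒∣ {suc n} {z} eq with z % suc n ≟ 0 | eq
... | yes z%n≡0 | _ = m%n≡0⇒n∣m z (suc n) z%n≡0

∣⇒isZeroMod : ∀ {n z} .{{_ : NonZero n}} → n ∣ z → isZeroMod n z ≡ true
∣⇒isZeroMod {suc n} {z} n∣z = cong (λ r → ⌊ r ≟ 0 ⌋) (n∣m⇒m%n≡0 z (suc n) n∣z)

∈-nonzeroResidues⁻ : ∀ {n x} → x ∈ nonzeroResidues n → x ≢ 0 × x < n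
∈-nonzeroResidues⁻ {n} x∈ with x∈upTo , x≢0 ← ∈-filter⁻ (λ a → ¬? (a ≟ 0)) {xs = upTo n} x∈ =
  x≢0 , ∈-upTo⁻ x∈upTo

∈-nonzeroResidues⁺ : ∀ {n x} → x ≢ 0 → x < n → x ∈ nonzeroResidues n
∈-nonzeroResidues⁺ x≢0 x<n = ∈-filter⁺ (λ a → ¬? (a ≟ 0)) (∈-upTo⁺ x<n) x≢0

∈-ZDGraph⁻ : ∀ {n x} .{{_ : NonZero n}} → x ∈ verts (ZDGraph n) → ∃[ b ] b ≢ 0 × b < n × n ∣ x * b
∈-ZDGraph⁻ {n} {x} x∈
  with _ , zd ← ∈-filter⁻ (λ a → isZeroDivisor n a Bool.≟ true) {xs = nonzeroResidues n} x∈
  with b , b∈ , xb≡0 ← find (any⁻ _ (nonzeroResidues n) (Equivalence.from T-≡ zd))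
  with b≢0 , b<n ← ∈-nonzeroResidues⁻ b∈ =
  b , b≢0 , b<n , isZeroMod⇒∣ (Equivalence.to T-≡ xb≡0)

∈-ZDGraph⁺ : ∀ {n x b} .{{_ : NonZero n}} → x ≢ 0 → x < n → b ≢ 0 → b < n → n ∣ x * b →
             x ∈ verts (ZDGraph n)
∈-ZDGraph⁺ {n} {x} x≢0 x<n b≢0 b<n n∣xb =
  ∈-filter⁺ (λ a → isZeroDivisor n a Bool.≟ true) (∈-nonzeroResidues⁺ x≢0 x<n)
    (Equivalence.to T-≡ (any⁺ (λ b → isZeroMod n (x * b))
      (lose (∈-nonzeroResidues⁺ b≢0 b<n) (Equivalence.from T-≡ (∣⇒isZeroMod n∣xb)))))

ZDGraph-unique : ∀ n → Unique (verts (ZDGraph n))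
ZDGraph-unique n = Unique.filter⁺ _ (Unique.filter⁺ _ (Unique.upTo⁺ n))

p*p∣m*n⇒p∣m⊎p*p∣n : ∀ {p} m n → Prime p → p * p ∣ m * n → p ∣ m ⊎ p * p ∣ n
p*p∣m*n⇒p∣m⊎p*p∣n {p} m n pr pp∣mn with euclidsLemma m n pr (∣-trans (m∣m*n p) pp∣mn)
... | inj₁ p∣m = inj₁ p∣m
... | inj₂ (divides q refl) with euclidsLemma m q pr (*-cancelʳ-∣ p p*p∣m*q*p)
  where
  instance
    p≢0 : NonZero p
    p≢0 = prime⇒nonZero pr
  p*p∣m*q*p : p * p ∣ m * q * p
  p*p∣m*q*p = subst (p * p ∣_) (sym (*-assoc m q p)) pp∣mn
...   | inj₁ p∣m = inj₁ p∣m
...   | inj₂ p∣q = inj₂ (*-monoˡ-∣ p p∣q)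

module _ {p : ℕ} (pr : Prime p) where

  private instance
    p≢0 : NonZero p
    p≢0 = prime⇒nonZero pr
    p*p≢0 : NonZero (p * p)
    p*p≢0 = m*n≢0 p p

  ZDGraph-square-vertex-divisible : ∀ {x} → x ∈ verts (ZDGraph (p * p)) → p ∣ x
  ZDGraph-square-vertex-divisible {x} x∈ with b , b≢0 , b<pp , pp∣xb ← ∈-ZDGraph⁻ {p * p} x∈
    with p*p∣m*n⇒p∣m⊎p*p∣n x b pr pp∣xb
  ... | inj₁ p∣x  = p∣x
  ... | inj₂ pp∣b = ⊥-elim (<⇒≱ b<pp (∣⇒≤ {{≢-nonZero b≢0}} pp∣b))

  ZDGraph-square-complete : IsComplete (ZDGraph (p * p))
  ZDGraph-square-complete {x} {y} x∈ y∈ = trans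
    (cong (not ⌊ x ≟ y ⌋ ∧_) (∣⇒isZeroMod
      (*-pres-∣ (ZDGraph-square-vertex-divisible x∈) (ZDGraph-square-vertex-divisible y∈))))
    (∧-identityʳ _)

  multiple∈ZDGraph-square : ∀ {a} → a ≢ 0 → a < p → a * p ∈ verts (ZDGraph (p * p))
  multiple∈ZDGraph-square {a} a≢0 a<p =
    ∈-ZDGraph⁺ (≢-nonZero⁻¹ (a * p)) (*-monoˡ-< p a<p) (≢-nonZero⁻¹ p) p<p*p (divides a (*-assoc a p p))
    where
    instance
      a*p≢0 : NonZero (a * p)
      a*p≢0 = m*n≢0 a p {{≢-nonZero a≢0}}
    p<p*p : p < p * p
    p<p*p = m<m*n p p (nonTrivial⇒n>1 p {{prime⇒nonTrivial pr}})

  ZDGraph-square-size : pred p ≤ length (verts (ZDGraph (p * p)))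
  ZDGraph-square-size = begin
    pred p                                ≡⟨ length-upTo (pred p) ⟨
    length (upTo (pred p))                ≡⟨ length-map multiple (upTo (pred p)) ⟨
    length (map multiple (upTo (pred p))) ≤⟨ unique-⊆⇒length-≤ multiples-unique multiples⊆verts ⟩
    length (verts (ZDGraph (p * p)))      ∎
    where
    open ≤-Reasoning
    multiple : ℕ → ℕ
    multiple i = suc i * p
    multiple-injective : ∀ {i j} → multiple i ≡ multiple j → i ≡ j
    multiple-injective eq = suc-injective (*-cancelʳ-≡ _ _ p eq)
    multiples-unique : Unique (map multiple (upTo (pred p)))
    multiples-unique = Unique.map⁺ multiple-injective (Unique.upTo⁺ (pred p))
    multiples⊆verts : map multiple (upTo (pred p)) ⊆ verts (ZDGraph (p * p))
    multiples⊆verts y∈ with i , i∈ , refl ← ∈-map⁻ multiple y∈ =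
      multiple∈ZDGraph-square (λ ()) (m≤pred[n]⇒suc[m]≤n (∈-upTo⁻ i∈))

prime>3⇒>4 : ∀ {p} → Prime p → p > 3 → p > 4
prime>3⇒>4 pr p>3 with m≤n⇒m<n∨m≡n p>3
... | inj₁ p>4 = p>4
... | inj₂ refl = ⊥-elim (composite⇒¬prime composite[4] pr)

theorem2p11 : (m : ℕ) → Prime m → m > 3 → AdmitsDAML (ZDGraph 9 □ ZDGraph (m * m))
theorem2p11 m pr m>3 = K₂□Complete.admitsDAML (ZDGraph (m * m))
  (ZDGraph-unique (m * m)) (ZDGraph-square-complete pr) 4≤k
  where
  4≤k : 4 ≤ length (verts (ZDGraph (m * m)))
  4≤k = ≤-trans (suc[m]≤n⇒m≤pred[n] (prime>3⇒>4 pr m>3)) (ZDGraph-square-size pr)
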